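{- Over Bishop-style constructive mathematics, DFT implies UCT$_c'$. Here: - DFT: every decidable bar $B\subseteq\{0,1\}^*$ is uniform. - UCT$_c'$: every function $f\colon[0,1]\to\mathbb{R}$ with a continuous ternary modulus is uniformly continuous.
   Context: The setting is constructive. A set $B\subseteq\{0,1\}^*$ is a bar if $\forall\alpha\in\{0,1\}^{\mathbb{N}}\,\exists n\,B(\overline{\alpha}n)$. It is uniform if $\exists N\,\forall\alpha\,\exists n\le N\,B(\overline{\alpha}n)$. It is decidable if membership is decidable. Real numbers are regular sequences of rationals $\langle r_n\rangle$ with $|r_n-r_{n+1}|\le2^{ -(n+1)}$. Equality is $\langle r_n\rangle\simeq\langle q_n\rangle$ iff $\forall n\,|r_{n+1}-q_{n+1}|\le2^{ -n}$. Functions $[0,1]\to\mathbb{R}$ respect $\simeq$. For $s\in\{0,1,2\}^*$, define $N(\langle\rangle)=1$ and $N(s*\langle i\rangle)=2N(s)+(i-1)$. For $\alpha\in\{0,1,2\}^{\mathbb{N}}$, $\Phi(\alpha)=\langle2^{ -(n+1)}N(\overline{\alpha}n)\rangle_n$. A ternary modulus of $f$ is $g\colon\mathbb{N}\to\{0,1,2\}^{\mathbb{N}}\to\mathbb{N}$ with $\forall k\,\forall\alpha\,\forall x\in[0,1]\,(|\Phi(\alpha)-x|\le2^{ -g_k(\alpha)}\to|f(\Phi(\alpha))-f(x)|\le2^{ -k})$. It is continuous if each $g_k$ is pointwise continuous: $\forall\alpha\,\exists n\,\forall\beta\,(\overline{\alpha}n=\overline{\beta}n\to g_k(\alpha)=g_k(\beta))$.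 $f$ is uniformly continuous if there is $\omega$ with $\forall k\,\forall x,y\in[0,1]\,(|x-y|\le2^{ -\omega(k)}\to|f(x)-f(y)|\le2^{ -k})$. -}

module Defs where

open import Data.Nat using (ℕ; zero; suc; _≤_)
open import Data.Integer as ℤ using (ℤ; +_; -[1+_])
open import Data.Rational as ℚ using (ℚ; 0ℚ; 1ℚ; ½; _/_)
open import Data.Fin using (Fin; zero; suc)
open import Data.Bool using (Bool)
open import Data.List using (List; applyUpTo)
open import Data.Product using (Σ; ∃; ∃-syntax; _×_; _,_; proj₁)
open import Relation.Nullary using (Dec)
open import Relation.Binary.PropositionalEquality using (_≡_)

2^- : ℕ → ℚ
2^- zero    = 1ℚ
2^- (suc n) = ½ ℚ.* 2^- n

Seq : Set
Seq = ℕ → ℚ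

Regular : Seq → Set
Regular r = ∀ n → ℚ.∣ r n ℚ.- r (suc n) ∣ ℚ.≤ 2^- (suc n)

record ℝ : Set where
  constructor mkℝ
  field
    seq : Seq
    reg : Regular seq
open ℝ public

_≃ₛ_ : Seq → Seq → Set
r ≃ₛ q = ∀ n → ℚ.∣ r (suc n) ℚ.- q (suc n) ∣ ℚ.≤ 2^- n

_≤ₛ_ : Seq → Seq → Set
r ≤ₛ q = ∀ n → r (suc n) ℚ.≤ q (suc n) ℚ.+ 2^- n

subₛ : Seq → Seq → Seq
subₛ r q n = r (suc n) ℚ.- q (suc n)

absₛ : Seq → Seq
absₛ r n = ℚ.∣ r n ∣

constₛ : ℚ → Seq
constₛ q _ = q

_≃_ : ℝ → ℝ → Set
x ≃ y = seq x ≃ₛ seq y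

Dist≤ : ℝ → ℝ → ℚ → Set
Dist≤ x y q = absₛ (subₛ (seq x) (seq y)) ≤ₛ constₛ q

In01 : ℝ → Set
In01 x = (constₛ 0ℚ ≤ₛ seq x) × (seq x ≤ₛ constₛ 1ℚ)

I01 : Set
I01 = Σ ℝ In01

pt : I01 → ℝ
pt = proj₁

Respects : (I01 → ℝ) → Set
Respects f = ∀ (x y : I01) → pt x ≃ pt y → f x ≃ f y

init : {A : Set} → (ℕ → A) → ℕ → List A
init α n = applyUpTo α n

Bar : (List Bool → Set) → Set
Bar B = ∀ (α : ℕ → Bool) → ∃[ n ] B (init α n)

Uniform : (List Bool → Set) → Set
Uniform B = ∃[ N ] ∀ (α : ℕ → Bool) → ∃[ n ] (n ≤ N × B (init α n))

Decidable : (List Bool → Set) → Set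
Decidable B = ∀ s → Dec (B s)

DFT : Set₁
DFT = ∀ (B : List Bool → Set) → Decidable B → Bar B → Uniform B

digit : Fin 3 → ℤ
digit zero             = -[1+ 0 ]
digit (suc zero)       = + 0
digit (suc (suc zero)) = + 1

Nα : (ℕ → Fin 3) → ℕ → ℤ
Nα α zero    = + 1
Nα α (suc n) = (+ 2) ℤ.* Nα α n ℤ.+ digit (α n)

Φseq : (ℕ → Fin 3) → Seq
Φseq α n = 2^- (suc n) ℚ.* (Nα α n / 1)

-- Ternary modulus.  The regularity of Φ(α) and Φ(α) ∈ [0,1] (both provable)
-- are taken as arguments so that f can be applied to Φ(α).
TernaryModulus : (I01 → ℝ) → (ℕ → (ℕ → Fin 3) → ℕ) → Set
TernaryModulus f g =
  ∀ (k : ℕ) (α : ℕ → Fin 3) (rΦ : Regular (Φseq α)) (iΦ : In01 (mkℝ (Φseq α) rΦ))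
    (x : I01) →
    Dist≤ (mkℝ (Φseq α) rΦ) (pt x) (2^- (g k α)) →
    Dist≤ (f (mkℝ (Φseq α) rΦ , iΦ)) (f x) (2^- k)

ContinuousModulus : (ℕ → (ℕ → Fin 3) → ℕ) → Set
ContinuousModulus g =
  ∀ (k : ℕ) (α : ℕ → Fin 3) → ∃[ n ] ∀ (β : ℕ → Fin 3) →
    init α n ≡ init β n → g k α ≡ g k β

UniformlyContinuous : (I01 → ℝ) → Set
UniformlyContinuous f =
  Σ (ℕ → ℕ) λ ω → ∀ (k : ℕ) (x y : I01) →
    Dist≤ (pt x) (pt y) (2^- (ω k)) → Dist≤ (f x) (f y) (2^- k)

UCT'c : Set
UCT'c = ∀ (f : I01 → ℝ) → Respects f →
  (Σ (ℕ → (ℕ → Fin 3) → ℕ) λ g → (TernaryModulus f g × ContinuousModulus g)) → UniformlyContinuous f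

-- Every x ∈ [0,1] has a ternary expansion α, chosen greedily against the regular
-- approximations of x, such that Φ(β) lies within 2·2^-m of x whenever β agrees with α
-- on its first m digits. Coding each ternary digit by two bits, the binary words whose
-- decoded ternary prefix t satisfies g_K(t 0 0 ⋯) + 2 ≤ |t| form a decidable bar, by
-- continuity of g_K; DFT bounds the depth of this bar by some N_K. For x, y within
-- 2^-N_{k+1}, let β be the padded prefix of the expansion of x cut at the bar: both x and y
-- are within 2^-g_{k+1}(β) of Φ(β), so f x and f y are both within 2^-(k+1) of f(Φ(β)).

module Submission where

open import Defs
open import Data.Bool using (Bool; true; false)
open import Data.Fin using (Fin; zero; suc)
open import Data.Integer as ℤ using (+_)
import Data.Integer.Tactic.RingSolver as ℤ-Solver
open import Data.List using (List; []; _∷_; length)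
open import Data.List.Properties using (length-applyUpTo)
open import Data.Nat as ℕ using (ℕ; zero; suc; z≤n; s≤s; _⊓_; ⌊_/2⌋)
import Data.Nat.Properties as ℕ
open import Data.Product using (Σ; ∃-syntax; _×_; _,_; proj₁; proj₂)
open import Data.Rational using (ℚ; 0ℚ; 1ℚ; ½; _+_; _-_; _*_; -_; ∣_∣; _≤_; _≤?_; _/_; toℚᵘ; nonNegative)
import Data.Rational.Properties as ℚ
open import Data.Rational.Unnormalised as ℚᵘ using (mkℚᵘ; *≡*)
import Data.Rational.Unnormalised.Properties as ℚᵘ
open import Data.Sum using (inj₁; inj₂)
open import Function using (_∘_)
open import Relation.Binary.PropositionalEquality
open import Relation.Nullary using (yes; no)
open import Relation.Nullary.Decidable using (dec⇒maybe)
open import Tactic.RingSolver using (solve-∀; solve)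
open import Tactic.RingSolver.Core.AlmostCommutativeRing using (AlmostCommutativeRing; fromCommutativeRing)

ℚ-ring : AlmostCommutativeRing _ _
ℚ-ring = fromCommutativeRing ℚ.+-*-commutativeRing (λ x → dec⇒maybe (0ℚ ℚ.≟ x))

infixl 6 _⊕_
_⊕_ : ∀ {a b c d} → a ≤ b → c ≤ d → a + c ≤ b + d
_⊕_ = ℚ.+-mono-≤

-- A linear inequality a ≤ b is reduced to a sum x ≤ y of known ones by a
-- ring identity between the differences.
≤-from-difference : ∀ {a b x y} → x ≤ y → a - b ≡ x - y → a ≤ b
≤-from-difference {a} {b} {x} {y} x≤y eq =
  subst₂ _≤_ (trans (regroup x y b) (trans (cong (_+ b) (sym eq)) (cancel a b)))
             (sym (regroup′ y b)) (x≤y ⊕ ℚ.≤-refl {b - y})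
  where
  regroup : ∀ p q r → p + (r - q) ≡ (p - q) + r
  regroup = solve-∀ ℚ-ring
  regroup′ : ∀ q r → r ≡ q + (r - q)
  regroup′ = solve-∀ ℚ-ring
  cancel : ∀ p q → (p - q) + q ≡ p
  cancel = solve-∀ ℚ-ring

∣p∣≤q⇒p≤q : ∀ {p q} → ∣ p ∣ ≤ q → p ≤ q
∣p∣≤q⇒p≤q {p} ∣p∣≤q with ℚ.∣p∣≡p∨∣p∣≡-p p
... | inj₁ ∣p∣≡p  = subst (_≤ _) ∣p∣≡p ∣p∣≤q
... | inj₂ ∣p∣≡-p = ℚ.≤-trans p≤0 (ℚ.≤-trans (ℚ.0≤∣p∣ p) ∣p∣≤q)
  where
  p≤0 : p ≤ 0ℚ
  p≤0 = ≤-from-difference (subst (0ℚ ≤_) ∣p∣≡-p (ℚ.0≤∣p∣ p)) (solve (p ∷ []) ℚ-ring)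

∣p∣≤q⇒-q≤p : ∀ {p q} → ∣ p ∣ ≤ q → - q ≤ p
∣p∣≤q⇒-q≤p {p} {q} ∣p∣≤q =
  ≤-from-difference (∣p∣≤q⇒p≤q (subst (_≤ q) (sym (ℚ.∣-p∣≡∣p∣ p)) ∣p∣≤q)) (solve (p ∷ q ∷ []) ℚ-ring)

-q≤p≤q⇒∣p∣≤q : ∀ {p q} → - q ≤ p → p ≤ q → ∣ p ∣ ≤ q
-q≤p≤q⇒∣p∣≤q {p} {q} -q≤p p≤q with ℚ.∣p∣≡p∨∣p∣≡-p p
... | inj₁ ∣p∣≡p  = subst (_≤ q) (sym ∣p∣≡p) p≤q
... | inj₂ ∣p∣≡-p = subst (_≤ q) (sym ∣p∣≡-p) (≤-from-difference -q≤p (solve (p ∷ q ∷ []) ℚ-ring))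

p-q≤p : ∀ {p q} → 0ℚ ≤ q → p - q ≤ p
p-q≤p {p} {q} 0≤q = ≤-from-difference 0≤q (solve (p ∷ q ∷ []) ℚ-ring)

p≤p+q : ∀ {p q} → 0ℚ ≤ q → p ≤ p + q
p≤p+q {p} {q} 0≤q = ≤-from-difference 0≤q (solve (p ∷ q ∷ []) ℚ-ring)

p≤q+p : ∀ {p q} → 0ℚ ≤ q → p ≤ q + p
p≤q+p {p} {q} 0≤q = ≤-from-difference 0≤q (solve (p ∷ q ∷ []) ℚ-ring)

infix 4 _≈[_]_

record _≈[_]_ (p e q : ℚ) : Set where
  constructor between
  field
    lower : - e ≤ p - q
    upper : p - q ≤ e
open _≈[_]_ public

∣-∣≤⇒≈ : ∀ {p q e} → ∣ p - q ∣ ≤ e → p ≈[ e ] q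
∣-∣≤⇒≈ h = between (∣p∣≤q⇒-q≤p h) (∣p∣≤q⇒p≤q h)

≈⇒∣-∣≤ : ∀ {p q e} → p ≈[ e ] q → ∣ p - q ∣ ≤ e
≈⇒∣-∣≤ (between l u) = -q≤p≤q⇒∣p∣≤q l u

≈-refl : ∀ {p e} → 0ℚ ≤ e → p ≈[ e ] p
≈-refl {p} {e} 0≤e = between (≤-from-difference 0≤e (solve (p ∷ e ∷ []) ℚ-ring))
                             (≤-from-difference 0≤e (solve (p ∷ e ∷ []) ℚ-ring))

≈-sym : ∀ {p q e} → p ≈[ e ] q → q ≈[ e ] p
≈-sym {p} {q} {e} (between l u) = between (≤-from-difference u (solve (p ∷ q ∷ e ∷ []) ℚ-ring))
                                          (≤-from-difference l (solve (p ∷ q ∷ e ∷ []) ℚ-ring))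

≈-trans : ∀ {p q r e d} → p ≈[ e ] q → q ≈[ d ] r → p ≈[ e + d ] r
≈-trans {p} {q} {r} {e} {d} (between l u) (between l′ u′) =
  between (≤-from-difference (l ⊕ l′) (solve (p ∷ q ∷ r ∷ e ∷ d ∷ []) ℚ-ring))
          (≤-from-difference (u ⊕ u′) (solve (p ∷ q ∷ r ∷ e ∷ d ∷ []) ℚ-ring))

≈-weaken : ∀ {p q e d} → e ≤ d → p ≈[ e ] q → p ≈[ d ] q
≈-weaken {p} {q} {e} {d} e≤d (between l u) =
  between (≤-from-difference (e≤d ⊕ l) (solve (p ∷ q ∷ e ∷ d ∷ []) ℚ-ring)) (ℚ.≤-trans u e≤d)

2^-suc+2^-suc≡2^- : ∀ n → 2^- (suc n) + 2^- (suc n) ≡ 2^- n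
2^-suc+2^-suc≡2^- n = halves (2^- n)
  where
  halves : ∀ t → ½ * t + ½ * t ≡ t
  halves = solve-∀ ℚ-ring

0≤2^- : ∀ n → 0ℚ ≤ 2^- n
0≤2^- zero    = ℚ.≤ᵇ⇒≤ _
0≤2^- (suc n) = ℚ.*-monoˡ-≤-nonNeg ½ (0≤2^- n)

2^-suc≤2^- : ∀ n → 2^- (suc n) ≤ 2^- n
2^-suc≤2^- n = subst₂ _≤_ (ℚ.+-identityʳ h) (2^-suc+2^-suc≡2^- n) (ℚ.≤-refl {h} ⊕ 0≤2^- (suc n))
  where h = 2^- (suc n)

4·2^-[2+n]≡2^-n : ∀ n → let q = 2^- (suc (suc n)) in (q + q) + (q + q) ≡ 2^- n
4·2^-[2+n]≡2^-n n =
  trans (cong₂ _+_ (2^-suc+2^-suc≡2^- (suc n)) (2^-suc+2^-suc≡2^- (suc n))) (2^-suc+2^-suc≡2^- n)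

2^-[m⊓n]≤2^-m+2^-n : ∀ m n → 2^- (m ⊓ n) ≤ 2^- m + 2^- n
2^-[m⊓n]≤2^-m+2^-n m n with ℕ.≤-total m n
... | inj₁ m≤n = subst (λ i → 2^- i ≤ 2^- m + 2^- n) (sym (ℕ.m≤n⇒m⊓n≡m m≤n)) (p≤p+q (0≤2^- n))
... | inj₂ n≤m = subst (λ i → 2^- i ≤ 2^- m + 2^- n) (sym (ℕ.m≥n⇒m⊓n≡n n≤m)) (p≤q+p (0≤2^- m))

2^--antimono : ∀ {m n} → m ℕ.≤ n → 2^- n ≤ 2^- m
2^--antimono {zero}  {zero}  z≤n       = ℚ.≤-refl
2^--antimono {zero}  {suc n} z≤n       = ℚ.≤-trans (2^-suc≤2^- n) (2^--antimono {zero} {n} z≤n)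
2^--antimono {suc m} {suc n} (s≤s m≤n) = ℚ.*-monoˡ-≤-nonNeg ½ (2^--antimono m≤n)

module _ (x : ℝ) where

  private
    telescope : ∀ {i j} → i ℕ.≤′ j → seq x j ≈[ 2^- i - 2^- j ] seq x i
    telescope {i} ℕ.≤′-refl = ≈-refl (ℚ.≤-reflexive (sym (ℚ.+-inverseʳ (2^- i))))
    telescope {i} (ℕ.≤′-step {j} i≤′j) =
      subst (seq x (suc j) ≈[_] seq x i) (regroup (2^- (suc j)) (2^- i) (2^- j) (2^-suc+2^-suc≡2^- j))
        (≈-trans (≈-sym (∣-∣≤⇒≈ (reg x j))) (telescope i≤′j))
      where
      regroup : ∀ h a b → h + h ≡ b → h + (a - b) ≡ a - h
      regroup h a .(h + h) refl = solve (h ∷ a ∷ []) ℚ-ring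

  regular-≈ : ∀ {i j} → i ℕ.≤ j → seq x i ≈[ 2^- i ] seq x j
  regular-≈ {i} {j} i≤j =
    ≈-sym (≈-weaken (p-q≤p (0≤2^- j)) (telescope (ℕ.≤⇒≤′ i≤j)))

  regular-≈-any : ∀ i j → seq x i ≈[ 2^- i + 2^- j ] seq x j
  regular-≈-any i j with ℕ.≤-total i j
  ... | inj₁ i≤j = ≈-weaken (p≤p+q (0≤2^- j)) (regular-≈ i≤j)
  ... | inj₂ j≤i = ≈-weaken (p≤q+p (0≤2^- i)) (≈-sym (regular-≈ j≤i))

infix 4 _≈ℝ[_]_

record _≈ℝ[_]_ (x : ℝ) (q : ℚ) (y : ℝ) : Set where
  constructor near
  field
    at : ∀ n → seq x (suc (suc n)) ≈[ q + 2^- n ] seq y (suc (suc n))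
open _≈ℝ[_]_ public

Dist≤⇒≈ℝ : ∀ {x y q} → Dist≤ x y q → x ≈ℝ[ q ] y
Dist≤⇒≈ℝ d = near λ n → ∣-∣≤⇒≈ (d n)

≈ℝ⇒Dist≤ : ∀ {x y q} → x ≈ℝ[ q ] y → Dist≤ x y q
≈ℝ⇒Dist≤ x≈y n = ≈⇒∣-∣≤ (at x≈y n)

≈ℝ-refl : ∀ {x} → x ≈ℝ[ 0ℚ ] x
≈ℝ-refl = near λ n → ≈-refl (ℚ.≤-trans (0≤2^- n) (ℚ.≤-reflexive (sym (ℚ.+-identityˡ _))))

≈ℝ-sym : ∀ {x y q} → x ≈ℝ[ q ] y → y ≈ℝ[ q ] x
≈ℝ-sym x≈y = near λ n → ≈-sym (at x≈y n)

≈ℝ-weaken : ∀ {x y q p} → q ≤ p → x ≈ℝ[ q ] y → x ≈ℝ[ p ] y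
≈ℝ-weaken q≤p x≈y = near λ n → ≈-weaken (q≤p ⊕ ℚ.≤-refl) (at x≈y n)

≈ℝ-trans : ∀ {x y z q p} → x ≈ℝ[ q ] y → y ≈ℝ[ p ] z → x ≈ℝ[ q + p ] z
≈ℝ-trans {x} {y} {z} {q} {p} x≈y y≈z = near λ n →
  subst (seq x (suc (suc n)) ≈[_] seq z (suc (suc n))) (regroup q p (2^- (suc (suc n))) (4·2^-[2+n]≡2^-n n))
    (≈-trans (≈-trans (≈-trans (regular-≈ x (ℕ.m≤n+m _ 2)) (at x≈y (suc (suc n))))
                      (at y≈z (suc (suc n))))
             (≈-sym (regular-≈ z (ℕ.m≤n+m _ 2))))
  where
  regroup : ∀ q p u {e} → (u + u) + (u + u) ≡ e → ((u + (q + u)) + (p + u)) + u ≡ (q + p) + e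
  regroup q p u refl = solve (q ∷ p ∷ u ∷ []) ℚ-ring

toℚᵘ-/1 : ∀ i → toℚᵘ (i / 1) ℚᵘ.≃ mkℚᵘ i 0
toℚᵘ-/1 i = ℚ.toℚᵘ-fromℚᵘ (mkℚᵘ i 0)

/1-homo-+ : ∀ i j → (i ℤ.+ j) / 1 ≡ i / 1 + j / 1
/1-homo-+ i j = ℚ.toℚᵘ-injective (begin
  toℚᵘ ((i ℤ.+ j) / 1)            ≈⟨ toℚᵘ-/1 (i ℤ.+ j) ⟩
  mkℚᵘ (i ℤ.+ j) 0                ≈⟨ *≡* (cross-multiplied i j) ⟩
  mkℚᵘ i 0 ℚᵘ.+ mkℚᵘ j 0          ≈⟨ ℚᵘ.+-cong (toℚᵘ-/1 i) (toℚᵘ-/1 j) ⟨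
  toℚᵘ (i / 1) ℚᵘ.+ toℚᵘ (j / 1)  ≈⟨ ℚ.toℚᵘ-homo-+ (i / 1) (j / 1) ⟨
  toℚᵘ (i / 1 + j / 1)            ∎)
  where
  open ℚᵘ.≃-Reasoning
  cross-multiplied : ∀ i j → (i ℤ.+ j) ℤ.* + 1 ≡ (i ℤ.* + 1 ℤ.+ j ℤ.* + 1) ℤ.* + 1
  cross-multiplied = ℤ-Solver.solve-∀

/1-homo-* : ∀ i j → (i ℤ.* j) / 1 ≡ i / 1 * (j / 1)
/1-homo-* i j = ℚ.toℚᵘ-injective (begin
  toℚᵘ ((i ℤ.* j) / 1)            ≈⟨ toℚᵘ-/1 (i ℤ.* j) ⟩
  mkℚᵘ (i ℤ.* j) 0                ≈⟨ *≡* refl ⟩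
  mkℚᵘ i 0 ℚᵘ.* mkℚᵘ j 0          ≈⟨ ℚᵘ.*-cong (toℚᵘ-/1 i) (toℚᵘ-/1 j) ⟨
  toℚᵘ (i / 1) ℚᵘ.* toℚᵘ (j / 1)  ≈⟨ ℚ.toℚᵘ-homo-* (i / 1) (j / 1) ⟨
  toℚᵘ (i / 1 * (j / 1))          ∎)
  where open ℚᵘ.≃-Reasoning

⟦_⟧ : Fin 3 → ℚ
⟦ d ⟧ = digit d / 1

∣⟦d⟧∣≤1 : ∀ d → ∣ ⟦ d ⟧ ∣ ≤ 1ℚ
∣⟦d⟧∣≤1 zero             = ℚ.≤ᵇ⇒≤ _
∣⟦d⟧∣≤1 (suc zero)       = ℚ.≤ᵇ⇒≤ _
∣⟦d⟧∣≤1 (suc (suc zero)) = ℚ.≤ᵇ⇒≤ _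

+-scaled-digit-≈ : ∀ {u} p d → 0ℚ ≤ u → p + u * ⟦ d ⟧ ≈[ u ] p
+-scaled-digit-≈ {u} p d 0≤u = ∣-∣≤⇒≈ (begin
  ∣ (p + u * ⟦ d ⟧) - p ∣   ≡⟨ cong ∣_∣ (cancel p (u * ⟦ d ⟧)) ⟩
  ∣ u * ⟦ d ⟧ ∣             ≡⟨ ℚ.∣p*q∣≡∣p∣*∣q∣ u ⟦ d ⟧ ⟩
  ∣ u ∣ * ∣ ⟦ d ⟧ ∣         ≡⟨ cong (_* ∣ ⟦ d ⟧ ∣) (ℚ.0≤p⇒∣p∣≡p 0≤u) ⟩
  u * ∣ ⟦ d ⟧ ∣             ≤⟨ ℚ.*-monoˡ-≤-nonNeg u {{nonNegative 0≤u}} (∣⟦d⟧∣≤1 d) ⟩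
  u * 1ℚ                    ≡⟨ ℚ.*-identityʳ u ⟩
  u                         ∎)
  where
  open ℚ.≤-Reasoning
  cancel : ∀ p q → (p + q) - p ≡ q
  cancel = solve-∀ ℚ-ring

Φseq-suc : ∀ α n → Φseq α (suc n) ≡ Φseq α n + 2^- (suc (suc n)) * ⟦ α n ⟧
Φseq-suc α n = begin
  ½ * t * ((+ 2 ℤ.* N ℤ.+ digit d) / 1)   ≡⟨ cong (½ * t *_) (/1-homo-+ (+ 2 ℤ.* N) (digit d)) ⟩
  ½ * t * ((+ 2 ℤ.* N) / 1 + ⟦ d ⟧)       ≡⟨ cong (λ z → ½ * t * (z + ⟦ d ⟧)) (/1-homo-* (+ 2) N) ⟩
  ½ * t * (+ 2 / 1 * (N / 1) + ⟦ d ⟧)     ≡⟨ distribute t (N / 1) ⟦ d ⟧ ⟩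
  t * (N / 1) + ½ * t * ⟦ d ⟧             ∎
  where
  open ≡-Reasoning
  t = 2^- (suc n)
  N = Nα α n
  d = α n
  distribute : ∀ t p q → ½ * t * (+ 2 / 1 * p + q) ≡ t * p + ½ * t * q
  distribute = solve-∀ ℚ-ring

Φseq-step : ∀ α n → Φseq α (suc n) ≈[ 2^- (suc (suc n)) ] Φseq α n
Φseq-step α n = subst (_≈[ 2^- (suc (suc n)) ] Φseq α n) (sym (Φseq-suc α n))
  (+-scaled-digit-≈ (Φseq α n) (α n) (0≤2^- (suc (suc n))))

Φseq-regular : ∀ α → Regular (Φseq α)
Φseq-regular α n = ≈⇒∣-∣≤ (≈-weaken (2^-suc≤2^- (suc n)) (≈-sym (Φseq-step α n)))

Φℝ : (ℕ → Fin 3) → ℝ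
Φℝ α = mkℝ (Φseq α) (Φseq-regular α)

≈-lower-bound : ∀ {p q e} → p ≈[ e ] q → e + e ≤ q → e ≤ p
≈-lower-bound {p} {q} {e} p≈q 2e≤q =
  ≤-from-difference (lower p≈q ⊕ 2e≤q) (solve (p ∷ q ∷ e ∷ []) ℚ-ring)

≈-upper-bound : ∀ {p q e c} → p ≈[ e ] q → q + (e + e) ≤ c → p + e ≤ c
≈-upper-bound {p} {q} {e} {c} p≈q q+2e≤c =
  ≤-from-difference (upper p≈q ⊕ q+2e≤c) (solve (p ∷ q ∷ e ∷ c ∷ []) ℚ-ring)

Φseq-bounded : ∀ α n → 2^- (suc n) ≤ Φseq α n × Φseq α n + 2^- (suc n) ≤ 1ℚ
Φseq-bounded α zero = ℚ.≤ᵇ⇒≤ _ , ℚ.≤ᵇ⇒≤ _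
Φseq-bounded α (suc n) with Φseq-bounded α n
... | above , below = ≈-lower-bound (Φseq-step α n) (subst (_≤ Φseq α n) (sym halves) above)
                    , ≈-upper-bound (Φseq-step α n) (subst (λ e → Φseq α n + e ≤ 1ℚ) (sym halves) below)
  where
  halves : 2^- (suc (suc n)) + 2^- (suc (suc n)) ≡ 2^- (suc n)
  halves = 2^-suc+2^-suc≡2^- (suc n)

Φℝ∈[0,1] : ∀ α → In01 (Φℝ α)
Φℝ∈[0,1] α = (λ n → ℚ.≤-trans (ℚ.≤-trans (0≤2^- (suc (suc n))) (proj₁ (Φseq-bounded α (suc n))))
                                (p≤p+q (0≤2^- n)))
           , (λ n → ℚ.≤-trans (ℚ.≤-trans (p≤p+q (0≤2^- (suc (suc n)))) (proj₂ (Φseq-bounded α (suc n))))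
                                (p≤p+q (0≤2^- n)))

AgreeBelow : {A : Set} → ℕ → (ℕ → A) → (ℕ → A) → Set
AgreeBelow m α β = ∀ i → i ℕ.< m → α i ≡ β i

Nα-agree : ∀ {m α β} → AgreeBelow m α β → ∀ {j} → j ℕ.≤ m → Nα α j ≡ Nα β j
Nα-agree α≐β {zero}  _   = refl
Nα-agree α≐β {suc j} j<m =
  cong₂ (λ N d → + 2 ℤ.* N ℤ.+ digit d) (Nα-agree α≐β (ℕ.<⇒≤ j<m)) (α≐β j j<m)

Φseq-agree : ∀ {m α β} → AgreeBelow m α β → ∀ {j} → j ℕ.≤ m → Φseq α j ≡ Φseq β j
Φseq-agree α≐β {j} j≤m = cong (λ N → 2^- (suc j) * (N / 1)) (Nα-agree α≐β j≤m)

data Digit (a v c : ℚ) : Fin 3 → Set where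
  down : a + v ≤ c → Digit a v c zero
  stay : a ≈[ v ] c → Digit a v c (suc zero)
  up   : c + v ≤ a → Digit a v c (suc (suc zero))

digit-toward : ∀ a v c → Σ (Fin 3) (Digit a v c)
digit-toward a v c with a + v ≤? c | c + v ≤? a
... | yes a+v≤c | _         = zero , down a+v≤c
... | no _      | yes c+v≤a = suc (suc zero) , up c+v≤a
... | no a+v≰c  | no c+v≰a  = suc zero , stay (between
  (≤-from-difference (ℚ.<⇒≤ (ℚ.≰⇒> a+v≰c)) (solve (a ∷ v ∷ c ∷ []) ℚ-ring))
  (≤-from-difference (ℚ.<⇒≤ (ℚ.≰⇒> c+v≰a)) (solve (a ∷ v ∷ c ∷ []) ℚ-ring)))

≈-shift-down : ∀ {p c w E} → p ≈[ (w + w) + E ] c → p - c ≤ E → p ≈[ w + E ] c - w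
≈-shift-down {p} {c} {w} {E} p≈c p-c≤E = between
  (≤-from-difference (lower p≈c) (solve (p ∷ c ∷ w ∷ E ∷ []) ℚ-ring))
  (≤-from-difference p-c≤E (solve (p ∷ c ∷ w ∷ E ∷ []) ℚ-ring))

≈-shift-up : ∀ {p c w E} → p ≈[ (w + w) + E ] c → - E ≤ p - c → p ≈[ w + E ] c + w
≈-shift-up {p} {c} {w} {E} p≈c -E≤p-c = between
  (≤-from-difference -E≤p-c (solve (p ∷ c ∷ w ∷ E ∷ []) ℚ-ring))
  (≤-from-difference (upper p≈c) (solve (p ∷ c ∷ w ∷ E ∷ []) ℚ-ring))

≈-below : ∀ {p a c e v} → p ≈[ e + v ] a → a + v ≤ c → p - c ≤ e
≈-below {p} {a} {c} {e} {v} p≈a a+v≤c =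
  ≤-from-difference (upper p≈a ⊕ a+v≤c) (solve (p ∷ a ∷ c ∷ e ∷ v ∷ []) ℚ-ring)

≈-above : ∀ {p a c e v} → p ≈[ e + v ] a → c + v ≤ a → - e ≤ p - c
≈-above {p} {a} {c} {e} {v} p≈a c+v≤a =
  ≤-from-difference (c+v≤a ⊕ lower p≈a) (solve (p ∷ a ∷ c ∷ e ∷ v ∷ []) ℚ-ring)

refine : ∀ {p a c e v d} → 0ℚ ≤ e → p ≈[ e + v ] a → Digit a v c d →
         p ≈[ ((v + v) + (v + v)) + (e + e) ] c →
         p ≈[ (v + v) + (e + e) ] c + (v + v) * ⟦ d ⟧
refine {p} {a} {c} {e} {v} 0≤e p≈a (down a+v≤c) p≈c =
  subst (p ≈[ (v + v) + (e + e) ]_) (sym (minus-one c (v + v)))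
    (≈-shift-down p≈c (ℚ.≤-trans (≈-below {e = e} p≈a a+v≤c) (p≤p+q 0≤e)))
  where
  minus-one : ∀ c w → c + w * ⟦ zero ⟧ ≡ c - w
  minus-one = solve-∀ ℚ-ring
refine {p} {a} {c} {e} {v} 0≤e p≈a (stay a≈c) p≈c =
  subst (p ≈[ (v + v) + (e + e) ]_) (sym (times-zero c (v + v)))
    (≈-weaken {e = (e + v) + v} (≤-from-difference 0≤e (solve (e ∷ v ∷ []) ℚ-ring)) (≈-trans p≈a a≈c))
  where
  times-zero : ∀ c w → c + w * ⟦ suc zero ⟧ ≡ c
  times-zero = solve-∀ ℚ-ring
refine {p} {a} {c} {e} {v} 0≤e p≈a (up c+v≤a) p≈c =
  subst (p ≈[ (v + v) + (e + e) ]_) (sym (plus-one c (v + v)))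
    (≈-shift-up p≈c (ℚ.≤-trans (ℚ.neg-antimono-≤ (p≤p+q {e} 0≤e)) (≈-above {e = e} p≈a c+v≤a)))
  where
  plus-one : ∀ c w → c + w * ⟦ suc (suc zero) ⟧ ≡ c + w
  plus-one = solve-∀ ℚ-ring

≈-½ : ∀ {p e} → 0ℚ ≤ p + e → p ≤ 1ℚ + e → p ≈[ ½ + e ] ½
≈-½ {p} {e} 0≤p+e p≤1+e = between
  (≤-from-difference 0≤p+e (lower-gap p e))
  (≤-from-difference p≤1+e (upper-gap p e))
  where
  lower-gap : ∀ p e → - (½ + e) - (p - ½) ≡ 0ℚ - (p + e)
  lower-gap = solve-∀ ℚ-ring
  upper-gap : ∀ p e → (p - ½) - (½ + e) ≡ p - (1ℚ + e)
  upper-gap = solve-∀ ℚ-ring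

module Expansion (x : ℝ) (x∈[0,1] : In01 x) where

  -- Stage j compares the current centre with x_{j+3}, which is within 2^-(j+3) of x.
  choice : ∀ j c → Σ (Fin 3) (Digit (seq x (3 ℕ.+ j)) (2^- (3 ℕ.+ j)) c)
  choice j c = digit-toward (seq x (3 ℕ.+ j)) (2^- (3 ℕ.+ j)) c

  centre : ℕ → ℚ
  expansion : ℕ → Fin 3

  centre zero    = ½
  centre (suc j) = centre j + 2^- (2 ℕ.+ j) * ⟦ expansion j ⟧

  expansion j = proj₁ (choice j (centre j))

  Φseq-expansion : ∀ j → Φseq expansion j ≡ centre j
  Φseq-expansion zero    = refl
  Φseq-expansion (suc j) =
    trans (Φseq-suc expansion j) (cong (_+ 2^- (2 ℕ.+ j) * ⟦ expansion j ⟧) (Φseq-expansion j))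

  Centred : ℕ → ℚ → Set
  Centred j c = ∀ n → seq x n ≈[ 2^- (suc j) + (2^- n + 2^- n) ] c

  centred : ∀ j → Centred j (centre j)
  centred zero n =
    subst (seq x n ≈[_] ½) (regroup (2^- n))
      (≈-trans (regular-≈ x (ℕ.n≤1+n n)) (≈-½ (proj₁ x∈[0,1] n) (proj₂ x∈[0,1] n)))
    where
    regroup : ∀ e → e + (½ + e) ≡ ½ + (e + e)
    regroup = solve-∀ ℚ-ring
  centred (suc j) n =
    subst (λ w → seq x n ≈[ w + E ] centre j + w * ⟦ expansion j ⟧) (2^-suc+2^-suc≡2^- (2 ℕ.+ j))
      (refine (0≤2^- n) (regular-≈-any x n (3 ℕ.+ j)) (proj₂ (choice j (centre j)))
              (subst (λ w → seq x n ≈[ w + E ] centre j) (sym (4·2^-[2+n]≡2^-n (suc j))) (centred j n)))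
    where
    E = 2^- n + 2^- n

  Φℝ-≈ : ∀ {m β} → AgreeBelow m β expansion → Φℝ β ≈ℝ[ 2^- m + 2^- m ] x
  Φℝ-≈ {m} {β} β≐α = near close
    where
    close : ∀ n → Φseq β (suc (suc n)) ≈[ (2^- m + 2^- m) + 2^- n ] seq x (suc (suc n))
    close n = ≈-weaken bound (≈-trans Φβ≈Φβᵢ Φβᵢ≈x)
      where
      -- the last stage at which β is still known to follow the expansion
      i = suc (suc n) ⊓ m
      e = 2^- (suc (suc n))
      Φβ≈Φβᵢ : Φseq β (suc (suc n)) ≈[ 2^- i ] Φseq β i
      Φβ≈Φβᵢ = ≈-sym (regular-≈ (Φℝ β) (ℕ.m⊓n≤m (suc (suc n)) m))
      Φβᵢ≈x : Φseq β i ≈[ 2^- (suc i) + (e + e) ] seq x (suc (suc n))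
      Φβᵢ≈x = subst (_≈[ 2^- (suc i) + (e + e) ] seq x (suc (suc n)))
                (sym (trans (Φseq-agree β≐α (ℕ.m⊓n≤n (suc (suc n)) m)) (Φseq-expansion i)))
                (≈-sym (centred i (suc (suc n))))
      arith : ∀ {a b e M} → b ≤ a → a ≤ e + M → a + (b + (e + e)) ≤ (M + M) + ((e + e) + (e + e))
      arith {a} {b} {e} {M} b≤a a≤e+M =
        ≤-from-difference (b≤a ⊕ a≤e+M ⊕ a≤e+M) (solve (a ∷ b ∷ e ∷ M ∷ []) ℚ-ring)
      bound : 2^- i + (2^- (suc i) + (e + e)) ≤ (2^- m + 2^- m) + 2^- n
      bound = subst ((2^- i + (2^- (suc i) + (e + e))) ≤_) (cong (λ E → (2^- m + 2^- m) + E) (4·2^-[2+n]≡2^-n n))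
                (arith {e = e} {M = 2^- m} (2^-suc≤2^- i) (2^-[m⊓n]≤2^-m+2^-n (suc (suc n)) m))

fromBits : Bool → Bool → Fin 3
fromBits false false = zero
fromBits false true  = suc zero
fromBits true  _     = suc (suc zero)

highBit lowBit : Fin 3 → Bool
highBit zero             = false
highBit (suc zero)       = false
highBit (suc (suc zero)) = true
lowBit zero             = false
lowBit (suc zero)       = true
lowBit (suc (suc zero)) = false

fromBits-bits : ∀ d → fromBits (highBit d) (lowBit d) ≡ d
fromBits-bits zero             = refl
fromBits-bits (suc zero)       = refl
fromBits-bits (suc (suc zero)) = refl

encode : (ℕ → Fin 3) → ℕ → Bool
encode α zero          = highBit (α 0)
encode α (suc zero)    = lowBit (α 0)
encode α (suc (suc j)) = encode (α ∘ suc) j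

decode : (ℕ → Bool) → ℕ → Fin 3
decode γ i = fromBits (γ (i ℕ.* 2)) (γ (suc (i ℕ.* 2)))

decode-encode : ∀ α i → decode (encode α) i ≡ α i
decode-encode α zero    = fromBits-bits (α 0)
decode-encode α (suc i) = decode-encode (α ∘ suc) i

decodeList : List Bool → List (Fin 3)
decodeList (b ∷ b′ ∷ s) = fromBits b b′ ∷ decodeList s
decodeList _            = []

decodeList-init : ∀ γ n → decodeList (init γ n) ≡ init (decode γ) ⌊ n /2⌋
decodeList-init γ zero          = refl
decodeList-init γ (suc zero)    = refl
decodeList-init γ (suc (suc n)) = cong (fromBits (γ 0) (γ 1) ∷_) (decodeList-init (λ i → γ (suc (suc i))) n)

length-decodeList≤ : ∀ s → length (decodeList s) ℕ.≤ length s
length-decodeList≤ []           = z≤n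
length-decodeList≤ (_ ∷ [])     = z≤n
length-decodeList≤ (_ ∷ _ ∷ s) = s≤s (ℕ.m≤n⇒m≤1+n (length-decodeList≤ s))

padZeros : List (Fin 3) → ℕ → Fin 3
padZeros []      _       = zero
padZeros (d ∷ _) zero    = d
padZeros (_ ∷ t) (suc i) = padZeros t i

padZeros-init : ∀ α m → AgreeBelow m (padZeros (init α m)) α
padZeros-init α (suc m) zero    _         = refl
padZeros-init α (suc m) (suc i) (s≤s i<m) = padZeros-init (α ∘ suc) m i i<m

padZeros-decodeList-encode : ∀ α n → let t = decodeList (init (encode α) n) in
                             AgreeBelow (length t) (padZeros t) α
padZeros-decodeList-encode α n =
  subst (λ t → AgreeBelow (length t) (padZeros t) α) (sym (decodeList-init (encode α) n)) agrees
  where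
  t = init (decode (encode α)) ⌊ n /2⌋
  agrees : AgreeBelow (length t) (padZeros t) α
  agrees i i<l = trans (padZeros-init (decode (encode α)) ⌊ n /2⌋ i (subst (i ℕ.<_) (length-applyUpTo _ _) i<l))
                       (decode-encode α i)

init-cong : ∀ {A : Set} {α β : ℕ → A} n → AgreeBelow n α β → init α n ≡ init β n
init-cong zero    _   = refl
init-cong (suc n) α≐β = cong₂ _∷_ (α≐β 0 (s≤s z≤n)) (init-cong n (λ i i<n → α≐β (suc i) (s≤s i<n)))

module _ (g : ℕ → (ℕ → Fin 3) → ℕ) (K : ℕ) where

  Secures : List (Fin 3) → Set
  Secures t = suc (suc (g K (padZeros t))) ℕ.≤ length t

  secures? : Decidable (Secures ∘ decodeList)
  secures? s = suc (suc (g K (padZeros (decodeList s)))) ℕ.≤? length (decodeList s)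

  secures-bar : (∀ α → ∃[ n ] ∀ β → init α n ≡ init β n → g K α ≡ g K β) → Bar (Secures ∘ decodeList)
  secures-bar g-cont γ = m ℕ.+ m , subst Secures (sym decoded) secured
    where
    α = decode γ
    n₀ = proj₁ (g-cont α)
    m = suc (suc (g K α)) ℕ.+ n₀
    decoded : decodeList (init γ (m ℕ.+ m)) ≡ init α m
    decoded = trans (decodeList-init γ (m ℕ.+ m)) (cong (init α) (sym (ℕ.n≡⌊n+n/2⌋ m)))
    same-modulus : g K α ≡ g K (padZeros (init α m))
    same-modulus = proj₂ (g-cont α) _
      (init-cong n₀ (λ i i<n₀ → sym (padZeros-init α m i (ℕ.≤-trans i<n₀ (ℕ.m≤n+m n₀ _)))))
    secured : Secures (init α m)
    secured = subst₂ (λ G l → suc (suc G) ℕ.≤ l) same-modulus (sym (length-applyUpTo α m))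
                (ℕ.m≤m+n (suc (suc (g K α))) n₀)

3·2^-[2+n]≤2^-n : ∀ n → let q = 2^- (suc (suc n)) in (q + q) + q ≤ 2^- n
3·2^-[2+n]≤2^-n n =
  subst ((q + q) + q ≤_) (4·2^-[2+n]≡2^-n n) (ℚ.≤-refl {q + q} ⊕ p≤q+p (0≤2^- (suc (suc n))))
  where q = 2^- (suc (suc n))

module _ {f : I01 → ℝ} {g : ℕ → (ℕ → Fin 3) → ℕ} (g-mod : TernaryModulus f g) where

  ≈ℝ-via-Φ : ∀ K β m (x y : I01) → suc (suc (g K β)) ℕ.≤ m →
             Φℝ β ≈ℝ[ 2^- m + 2^- m ] pt x → pt x ≈ℝ[ 2^- m ] pt y →
             f x ≈ℝ[ 2^- K + 2^- K ] f y
  ≈ℝ-via-Φ K β m x y secured Φβ≈x x≈y =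
    ≈ℝ-trans (≈ℝ-sym (fΦβ≈ x (0≤2^- (suc (suc (g K β)))) ≈ℝ-refl)) (fΦβ≈ y 2^-m≤q x≈y)
    where
    q = 2^- (suc (suc (g K β)))
    2^-m≤q : 2^- m ≤ q
    2^-m≤q = 2^--antimono {n = m} secured
    fΦβ≈ : ∀ z {r} → r ≤ q → pt x ≈ℝ[ r ] pt z → f (Φℝ β , Φℝ∈[0,1] β) ≈ℝ[ 2^- K ] f z
    fΦβ≈ z r≤q x≈z = Dist≤⇒≈ℝ (g-mod K β (Φseq-regular β) (Φℝ∈[0,1] β) z (≈ℝ⇒Dist≤
      (≈ℝ-weaken (ℚ.≤-trans ((2^-m≤q ⊕ 2^-m≤q) ⊕ r≤q) (3·2^-[2+n]≤2^-n (g K β)))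
                 (≈ℝ-trans Φβ≈x x≈z))))

proposition5p9 : DFT → UCT'c
proposition5p9 dft f _ (g , g-mod , g-cont) = ω , f-uc
  where
  uniform-bar : ∀ K → Uniform (Secures g K ∘ decodeList)
  uniform-bar K = dft _ (secures? g K) (secures-bar g K (g-cont K))

  ω : ℕ → ℕ
  ω k = proj₁ (uniform-bar (suc k))

  f-uc : ∀ k (x y : I01) → Dist≤ (pt x) (pt y) (2^- (ω k)) → Dist≤ (f x) (f y) (2^- k)
  f-uc k x y x≈y = ≈ℝ⇒Dist≤ (subst (f x ≈ℝ[_] f y) (2^-suc+2^-suc≡2^- k)
      (≈ℝ-via-Φ {g = g} g-mod (suc k) β m x y secured
        (Φℝ-≈ (padZeros-decodeList-encode expansion n))
        (≈ℝ-weaken (2^--antimono {m} {ω k} m≤ω) (Dist≤⇒≈ℝ x≈y))))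
    where
    open Expansion (pt x) (proj₂ x)
    γ = encode expansion
    n = proj₁ (proj₂ (uniform-bar (suc k)) γ)
    n≤ω : n ℕ.≤ ω k
    n≤ω = proj₁ (proj₂ (proj₂ (uniform-bar (suc k)) γ))
    t = decodeList (init γ n)
    β = padZeros t
    m = length t
    secured : Secures g (suc k) t
    secured = proj₂ (proj₂ (proj₂ (uniform-bar (suc k)) γ))
    m≤ω : m ℕ.≤ ω k
    m≤ω = ℕ.≤-trans (length-decodeList≤ (init γ n)) (subst (ℕ._≤ ω k) (sym (length-applyUpTo γ n)) n≤ω)
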